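{- For every base $\mathcal{B}$ and every proposition $\phi$: $\Vdash_{\mathcal{B}} \phi$ (Sandqvist support) if and only if $\mathcal{B} \in [\![\phi]\!]_J$.
   Context: Fix a countably infinite set $\mathrm{At}$ of atoms. An atomic rule has the form $((P_1 \Rightarrow a_1), \dots, (P_n \Rightarrow a_n) \Rightarrow b)$ with $n \ge 0$, atoms $a_i, b$ and finite sets of atoms $P_i$. A base is a set of atomic rules; let $\mathcal{W}$ be the set of all bases, ordered by inclusion. Derivability $P \vdash_{\mathcal{B}} a$ is defined inductively by (Ref) $P, a \vdash_{\mathcal{B}} a$ and (App) for a rule $((P_1 \Rightarrow a_1),\dots,(P_n \Rightarrow a_n) \Rightarrow b) \in \mathcal{B}$ and finite $Q$, if $Q, P_i \vdash_{\mathcal{B}} a_i$ for all $i$ then $Q \vdash_{\mathcal{B}} b$ (commas denote union). Propositions are built from atoms, $\top$, $\bot$ using $\wedge, \vee, \supset$. Sandqvist support $\Vdash_{\mathcal{B}} \phi$: $\Vdash_{\mathcal{B}} a$ iff $\emptyset \vdash_{\mathcal{B}} a$; $\Vdash_{\mathcal{B}} \top$ always; $\Vdash_{\mathcal{B}} \phi \wedge \psi$ iff $\Vdash_{\mathcal{B}} \phi$ and $\Vdash_{\mathcal{B}} \psi$; $\Vdash_{\mathcal{B}} \phi \supset \psi$ iff $\phi \Vdash_{\mathcal{B}} \psi$; $\Vdash_{\mathcal{B}} \phi \vee \psi$ iff for every atom $a$ and every base $\mathcal{C} \supseteq \mathcal{B}$, if $\phi \Vdash_{\mathcal{C}} a$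 and $\psi \Vdash_{\mathcal{C}} a$ then $\Vdash_{\mathcal{C}} a$; $\Vdash_{\mathcal{B}} \bot$ iff $\Vdash_{\mathcal{B}} a$ for every atom $a$; where for nonempty $\Theta$, $\Theta \Vdash_{\mathcal{B}} \phi$ means for every $\mathcal{C} \supseteq \mathcal{B}$, if $\Vdash_{\mathcal{C}} \theta$ for all $\theta \in \Theta$ then $\Vdash_{\mathcal{C}} \phi$. Let $\mathcal{W}^\uparrow$ be the complete Heyting algebra of upward-closed subsets of $\mathcal{W}$ (order: inclusion; meets of nonempty families are intersections, joins are unions, $U \to V = \{\mathcal{B} \mid \forall \mathcal{C} \supseteq \mathcal{B},\ \mathcal{C} \in U \Rightarrow \mathcal{C} \in V\}$, top $\mathcal{W}$, bottom $\emptyset$). For an atom $a$ let $[\![a]\!] = \{\mathcal{B} \in \mathcal{W} \mid \emptyset \vdash_{\mathcal{B}} a\}$. Define $J : \mathcal{W}^\uparrow \to \mathcal{W}^\uparrow$ by $J(U) = \bigwedge_{b \in \mathrm{At}} ((U \to [\![b]\!]) \to [\![b]\!])$. The $J$-interpretation is: $[\![a]\!]_J = J([\![a]\!])$; $[\![\top]\!]_J = \mathcal{W}$; $[\![\phi \wedge \psi]\!]_J = [\![\phi]\!]_J \cap [\![\psi]\!]_J$; $[\![\phi \supset \psi]\!]_J = [\![\phi]\!]_J \to [\![\psi]\!]_J$; $[\![\bot]\!]_J = J(\emptyset)$; $[\![\phi \vee \psi]\!]_J = J([\![\phi]\!]_J \cup [\![\psi]\!]_J)$. -}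

module Defs where

open import Level using (Level; Lift; lift; lower) renaming (suc to lsuc; zero to lzero)
open import Data.Nat using (ℕ)
open import Data.List using (List; []; _++_)
open import Data.List.Membership.Propositional using (_∈_)
open import Data.List.Relation.Unary.All using (All)
open import Data.Product using (_×_; _,_; Σ)
open import Data.Sum using (_⊎_)
import Data.Empty as E
import Data.Unit as U

Atom : Set
Atom = ℕ

-- Finite sets of atoms are represented by lists (only membership matters).
FinSet : Set
FinSet = List Atom

-- An atomic rule ((P₁ ⇒ a₁), …, (Pₙ ⇒ aₙ) ⇒ b).
record Rule : Set where
  constructor _⇒_
  field
    prems : List (FinSet × Atom)
    concl : Atom
open Rule public

Base : Set₁
Base = Rule → Set

_⊆B_ : Base → Base → Set
B ⊆B C = ∀ r → B r → C r

-- Derivability  P ⊢_B a  (commas = union = list append).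
data _⊢[_]_ : FinSet → Base → Atom → Set₁ where
  ref : ∀ {B P a} → a ∈ P → P ⊢[ B ] a
  app : ∀ {B Q} (r : Rule) → B r →
        All (λ Pa → (Q ++ Data.Product.proj₁ Pa) ⊢[ B ] Data.Product.proj₂ Pa) (prems r) →
        Q ⊢[ B ] concl r

data Form : Set where
  atom : Atom → Form
  ⊤′ ⊥′ : Form
  _∧′_ _∨′_ _⊃′_ : Form → Form → Form

⊩[_]_ : Base → Form → Set₁
⊩[ B ] atom a = [] ⊢[ B ] a
⊩[ B ] ⊤′ = Lift _ U.⊤
⊩[ B ] ⊥′ = ∀ a → [] ⊢[ B ] a
⊩[ B ] (φ ∧′ ψ) = (⊩[ B ] φ) × (⊩[ B ] ψ)
⊩[ B ] (φ ⊃′ ψ) = ∀ C → B ⊆B C → ⊩[ C ] φ → ⊩[ C ] ψ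
⊩[ B ] (φ ∨′ ψ) = ∀ a C → B ⊆B C →
  (∀ D → C ⊆B D → ⊩[ D ] φ → [] ⊢[ D ] a) →
  (∀ D → C ⊆B D → ⊩[ D ] ψ → [] ⊢[ D ] a) →
  [] ⊢[ C ] a

-- Subsets of W (as predicates on bases). All sets built below are
-- upward closed; operations follow the Heyting algebra W↑.
WSet : Set₂
WSet = Base → Set₁

⟦_⟧at : Atom → WSet
⟦ a ⟧at B = [] ⊢[ B ] a

topW : WSet
topW _ = Lift _ U.⊤

botW : WSet
botW _ = Lift _ E.⊥

_∩W_ : WSet → WSet → WSet
(U ∩W V) B = U B × V B

_∪W_ : WSet → WSet → WSet
(U ∪W V) B = U B ⊎ V B

_⇒W_ : WSet → WSet → WSet
(U ⇒W V) B = ∀ C → B ⊆B C → U C → V C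

J : WSet → WSet
J U B = ∀ b → ((U ⇒W ⟦ b ⟧at) ⇒W ⟦ b ⟧at) B

⟦_⟧J : Form → WSet
⟦ atom a ⟧J = J ⟦ a ⟧at
⟦ ⊤′ ⟧J = topW
⟦ ⊥′ ⟧J = J botW
⟦ φ ∧′ ψ ⟧J = ⟦ φ ⟧J ∩W ⟦ ψ ⟧J
⟦ φ ⊃′ ψ ⟧J = ⟦ φ ⟧J ⇒W ⟦ ψ ⟧J
⟦ φ ∨′ ψ ⟧J = J (⟦ φ ⟧J ∪W ⟦ ψ ⟧J)

{-# OPTIONS --safe #-}
-- Support and the J-interpretation agree clause by clause; only three clauses
-- are not literally the same.  Atoms: ⟦ a ⟧at is upward closed, so it lies
-- below J ⟦ a ⟧at, and instantiating J at b = a gives the converse.  Falsum: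
-- everything implies every atom from botW, so J botW is the meet of all atoms.
-- Disjunction: Sandqvist's clause is J (U ∪W V) with the implication out of
-- U ∪W V split into one implication out of each disjunct.
module Submission where

open import Defs
open import Data.Product using (_×_; _,_; proj₁; proj₂)
open import Data.Sum using (inj₁; inj₂; [_,_])
open import Data.List using (List; _++_)
open import Data.List.Relation.Unary.All using (All; []; _∷_)
open import Function using (_∘_; id)
open import Relation.Unary using (_⊆_; _≐_)
open import Relation.Unary.Properties using (≐-refl; ≐-sym; ≐-trans)

⊆B-refl : ∀ {B} → B ⊆B B
⊆B-refl _ r∈B = r∈B

mutual
  ⊢-mono : ∀ {B C P a} → B ⊆B C → P ⊢[ B ] a → P ⊢[ C ] a
  ⊢-mono B⊆C (ref a∈P)       = ref a∈P
  ⊢-mono B⊆C (app r r∈B ds) = app r (B⊆C r r∈B) (All-⊢-mono B⊆C ds)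

  All-⊢-mono : ∀ {B C Q} {ps : List (FinSet × Atom)} → B ⊆B C →
               All (λ Pa → (Q ++ proj₁ Pa) ⊢[ B ] proj₂ Pa) ps →
               All (λ Pa → (Q ++ proj₁ Pa) ⊢[ C ] proj₂ Pa) ps
  All-⊢-mono B⊆C []       = []
  All-⊢-mono B⊆C (d ∷ ds) = ⊢-mono B⊆C d ∷ All-⊢-mono B⊆C ds

UpClosed : WSet → Set₁
UpClosed U = ∀ {B C} → B ⊆B C → U B → U C

⟦⟧at-upClosed : ∀ a → UpClosed ⟦ a ⟧at
⟦⟧at-upClosed a = ⊢-mono

Support : Form → WSet
Support φ B = ⊩[ B ] φ

⋂⟦⟧at : WSet
⋂⟦⟧at B = ∀ a → ⟦ a ⟧at B

-- Support (φ ∨′ ψ) is definitionally Support φ ⊔W Support ψ.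
_⊔W_ : WSet → WSet → WSet
(U ⊔W V) B = ∀ a C → B ⊆B C → (U ⇒W ⟦ a ⟧at) C → (V ⇒W ⟦ a ⟧at) C → ⟦ a ⟧at C

∩W-cong : ∀ {U U′ V V′} → U ≐ U′ → V ≐ V′ → (U ∩W V) ≐ (U′ ∩W V′)
∩W-cong (U⊆U′ , U′⊆U) (V⊆V′ , V′⊆V) =
  (λ (u , v) → U⊆U′ u , V⊆V′ v) , (λ (u , v) → U′⊆U u , V′⊆V v)

∪W-cong : ∀ {U U′ V V′} → U ≐ U′ → V ≐ V′ → (U ∪W V) ≐ (U′ ∪W V′)
∪W-cong (U⊆U′ , U′⊆U) (V⊆V′ , V′⊆V) =
  [ inj₁ ∘ U⊆U′ , inj₂ ∘ V⊆V′ ] , [ inj₁ ∘ U′⊆U , inj₂ ∘ V′⊆V ]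

⇒W-mono : ∀ {U U′ V V′} → U′ ⊆ U → V ⊆ V′ → (U ⇒W V) ⊆ (U′ ⇒W V′)
⇒W-mono U′⊆U V⊆V′ f C B⊆C u = V⊆V′ (f C B⊆C (U′⊆U u))

⇒W-cong : ∀ {U U′ V V′} → U ≐ U′ → V ≐ V′ → (U ⇒W V) ≐ (U′ ⇒W V′)
⇒W-cong (U⊆U′ , U′⊆U) (V⊆V′ , V′⊆V) = ⇒W-mono U′⊆U V⊆V′ , ⇒W-mono U⊆U′ V′⊆V

J-mono : ∀ {U V} → U ⊆ V → J U ⊆ J V
J-mono U⊆V j b C B⊆C k = j b C B⊆C (⇒W-mono U⊆V id k)

J-cong : ∀ {U V} → U ≐ V → J U ≐ J V
J-cong (U⊆V , V⊆U) = J-mono U⊆V , J-mono V⊆U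

J-unit : ∀ {U} → UpClosed U → U ⊆ J U
J-unit U-up u b C B⊆C k = k C ⊆B-refl (U-up B⊆C u)

J⟦⟧at⊆⟦⟧at : ∀ a → J ⟦ a ⟧at ⊆ ⟦ a ⟧at
J⟦⟧at⊆⟦⟧at a j = j a _ ⊆B-refl (λ _ _ d → d)

⟦⟧at≐J⟦⟧at : ∀ a → ⟦ a ⟧at ≐ J ⟦ a ⟧at
⟦⟧at≐J⟦⟧at a = J-unit (⟦⟧at-upClosed a) , J⟦⟧at⊆⟦⟧at a

J-botW≐⋂⟦⟧at : J botW ≐ ⋂⟦⟧at
J-botW≐⋂⟦⟧at =
  (λ j a → j a _ ⊆B-refl (λ _ _ ()))  ,
  (λ ds b C B⊆C _ → ⟦⟧at-upClosed b B⊆C (ds b))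

J-∪W≐⊔W : ∀ {U V} → J (U ∪W V) ≐ (U ⊔W V)
J-∪W≐⊔W =
  (λ j a C B⊆C kU kV → j a C B⊆C (λ D C⊆D → [ kU D C⊆D , kV D C⊆D ])) ,
  (λ j b C B⊆C k → j b C B⊆C (λ D C⊆D → k D C⊆D ∘ inj₁) (λ D C⊆D → k D C⊆D ∘ inj₂))

Support≐⟦⟧J : ∀ φ → Support φ ≐ ⟦ φ ⟧J
Support≐⟦⟧J (atom a) = ⟦⟧at≐J⟦⟧at a
Support≐⟦⟧J ⊤′       = ≐-refl
Support≐⟦⟧J ⊥′       = ≐-sym J-botW≐⋂⟦⟧at
Support≐⟦⟧J (φ ∧′ ψ) = ∩W-cong (Support≐⟦⟧J φ) (Support≐⟦⟧J ψ)
Support≐⟦⟧J (φ ⊃′ ψ) = ⇒W-cong (Support≐⟦⟧J φ) (Support≐⟦⟧J ψ)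
Support≐⟦⟧J (φ ∨′ ψ) =
  ≐-trans (≐-sym J-∪W≐⊔W) (J-cong (∪W-cong (Support≐⟦⟧J φ) (Support≐⟦⟧J ψ)))

lemma13 : (B : Base) (φ : Form) → ((⊩[ B ] φ) → ⟦ φ ⟧J B) × (⟦ φ ⟧J B → ⊩[ B ] φ)
lemma13 B φ = proj₁ (Support≐⟦⟧J φ) , proj₂ (Support≐⟦⟧J φ)
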